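{- For all $P,Q \in \mathbb{Z}$ and $R \in \mathbb{Q}$, the set $\mathcal{L}(P,Q,R)$ is a semigroup, i.e., it contains $0$ and is closed under addition.
   Context: $\mathbb{N}=\{0,1,2,\ldots\}$. For $P,Q\in\mathbb{Z}$, the Lucas sequence $U_n=U_n(P,Q)$ is defined by $U_0=0$, $U_1=1$, $U_{n+2}=PU_{n+1}-QU_n$. For $R\in\mathbb{Q}$, the Lucas semigroup is $\mathcal{L}(P,Q,R)=\{n\in\mathbb{N} : U_nR\in\mathbb{Z}\}$. A semigroup means an additive subsemigroup of $\mathbb{N}$ containing $0$. -}

module Defs where

open import Data.Nat using (ℕ; zero; suc)
open import Data.Integer using (ℤ; +_; _-_)
import Data.Integer as ℤ
open import Data.Rational using (ℚ; _/_)
import Data.Rational as ℚ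
open import Data.Product using (∃)
open import Relation.Binary.PropositionalEquality using (_≡_)

U : ℤ → ℤ → ℕ → ℤ
U P Q zero = + 0
U P Q (suc zero) = + 1
U P Q (suc (suc n)) = P ℤ.* U P Q (suc n) - Q ℤ.* U P Q n

IsInt : ℚ → Set
IsInt x = ∃ λ (z : ℤ) → x ≡ z / 1

InL : ℤ → ℤ → ℚ → ℕ → Set
InL P Q R n = IsInt ((U P Q n / 1) ℚ.* R)

-- By the addition formula U(k+m+1) = U(k+1) U(m+1) − Q U(k) U(m), U(m+n) is an integer
-- combination of U(n) and U(m) when n ≥ 1, and integer combinations of the integers
-- U(n) R and U(m) R are integers.
module Submission where

open import Defs
open import Data.Nat using (ℕ; _+_; zero; suc)
open import Data.Integer using (ℤ)
open import Data.Rational using (ℚ; mkℚ; _/_)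
open import Data.Product using (_×_; _,_)

import Data.Nat.Properties as ℕ
import Data.Integer as ℤ
import Data.Integer.Properties as ℤ
open import Data.Integer.Tactic.RingSolver using (solve-∀)
import Data.Rational as ℚ
import Data.Rational.Properties as ℚ
import Data.Nat.Coprimality as Coprimality
open import Relation.Binary.PropositionalEquality

/1≡mkℚ : ∀ z → z / 1 ≡ mkℚ z 0 (Coprimality.sym (Coprimality.1-coprimeTo _))
/1≡mkℚ z = ℚ.↥p/↧p≡p (mkℚ z 0 (Coprimality.sym (Coprimality.1-coprimeTo _)))

/1-homo-+ : ∀ a b → (a ℤ.+ b) / 1 ≡ (a / 1) ℚ.+ (b / 1)
/1-homo-+ a b rewrite /1≡mkℚ a | /1≡mkℚ b | ℤ.*-identityʳ a | ℤ.*-identityʳ b = refl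

/1-homo-* : ∀ a b → (a ℤ.* b) / 1 ≡ (a / 1) ℚ.* (b / 1)
/1-homo-* a b rewrite /1≡mkℚ a | /1≡mkℚ b = refl

IsInt-+ : ∀ {x y} → IsInt x → IsInt y → IsInt (x ℚ.+ y)
IsInt-+ (a , refl) (b , refl) = a ℤ.+ b , sym (/1-homo-+ a b)

IsInt-*ˡ : ∀ a {x} → IsInt x → IsInt ((a / 1) ℚ.* x)
IsInt-*ˡ a (b , refl) = a ℤ.* b , sym (/1-homo-* a b)

IsInt-linear : ∀ (R : ℚ) a b c d → IsInt ((c / 1) ℚ.* R) → IsInt ((d / 1) ℚ.* R) →
  IsInt (((a ℤ.* c ℤ.+ b ℤ.* d) / 1) ℚ.* R)
IsInt-linear R a b c d hc hd =
  subst IsInt (sym expand) (IsInt-+ (IsInt-*ˡ a hc) (IsInt-*ˡ b hd))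
  where
  open ≡-Reasoning
  expand : ((a ℤ.* c ℤ.+ b ℤ.* d) / 1) ℚ.* R ≡ (a / 1) ℚ.* ((c / 1) ℚ.* R) ℚ.+ (b / 1) ℚ.* ((d / 1) ℚ.* R)
  expand = begin
    ((a ℤ.* c ℤ.+ b ℤ.* d) / 1) ℚ.* R
      ≡⟨ cong (ℚ._* R) (trans (/1-homo-+ (a ℤ.* c) (b ℤ.* d)) (cong₂ ℚ._+_ (/1-homo-* a c) (/1-homo-* b d))) ⟩
    ((a / 1) ℚ.* (c / 1) ℚ.+ (b / 1) ℚ.* (d / 1)) ℚ.* R
      ≡⟨ ℚ.*-distribʳ-+ R ((a / 1) ℚ.* (c / 1)) ((b / 1) ℚ.* (d / 1)) ⟩
    (a / 1) ℚ.* (c / 1) ℚ.* R ℚ.+ (b / 1) ℚ.* (d / 1) ℚ.* R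
      ≡⟨ cong₂ ℚ._+_ (ℚ.*-assoc (a / 1) (c / 1) R) (ℚ.*-assoc (b / 1) (d / 1) R) ⟩
    (a / 1) ℚ.* ((c / 1) ℚ.* R) ℚ.+ (b / 1) ℚ.* ((d / 1) ℚ.* R) ∎

U-suc-+ : ∀ P Q k m → U P Q (suc (k + m)) ≡ U P Q (suc k) ℤ.* U P Q (suc m) ℤ.- Q ℤ.* (U P Q k ℤ.* U P Q m)
U-suc-+ P Q zero m = base₀ Q (U P Q (suc m)) (U P Q m)
  where base₀ : ∀ q a b → a ≡ ℤ.+ 1 ℤ.* a ℤ.- q ℤ.* (ℤ.+ 0 ℤ.* b)
        base₀ = solve-∀
U-suc-+ P Q (suc zero) m = base₁ P Q (U P Q (suc m)) (U P Q m)
  where base₁ : ∀ p q a b → p ℤ.* a ℤ.- q ℤ.* b ≡ (p ℤ.* ℤ.+ 1 ℤ.- q ℤ.* ℤ.+ 0) ℤ.* a ℤ.- q ℤ.* (ℤ.+ 1 ℤ.* b)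
        base₁ = solve-∀
U-suc-+ P Q (suc (suc k)) m rewrite U-suc-+ P Q (suc k) m | U-suc-+ P Q k m =
  step P Q (U P Q (suc m)) (U P Q m) (U P Q (suc k)) (U P Q k)
  where step : ∀ p q a b u v →
                 p ℤ.* ((p ℤ.* u ℤ.- q ℤ.* v) ℤ.* a ℤ.- q ℤ.* (u ℤ.* b)) ℤ.- q ℤ.* (u ℤ.* a ℤ.- q ℤ.* (v ℤ.* b))
               ≡ (p ℤ.* (p ℤ.* u ℤ.- q ℤ.* v) ℤ.- q ℤ.* u) ℤ.* a ℤ.- q ℤ.* ((p ℤ.* u ℤ.- q ℤ.* v) ℤ.* b)
        step = solve-∀

InL-+ : ∀ P Q R m n → InL P Q R m → InL P Q R n → InL P Q R (m + n)
InL-+ P Q R m zero hm _ rewrite ℕ.+-identityʳ m = hm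
InL-+ P Q R m (suc k) hm hn rewrite ℕ.+-suc m k | ℕ.+-comm m k =
  subst (λ z → IsInt ((z / 1) ℚ.* R)) (sym expansion)
    (IsInt-linear R (U P Q (suc m)) (ℤ.- (Q ℤ.* U P Q k)) (U P Q (suc k)) (U P Q m) hn hm)
  where
  as-combination : ∀ q a b c d → a ℤ.* b ℤ.- q ℤ.* (c ℤ.* d) ≡ b ℤ.* a ℤ.+ ℤ.- (q ℤ.* c) ℤ.* d
  as-combination = solve-∀
  expansion : U P Q (suc (k + m)) ≡ U P Q (suc m) ℤ.* U P Q (suc k) ℤ.+ ℤ.- (Q ℤ.* U P Q k) ℤ.* U P Q m
  expansion = trans (U-suc-+ P Q k m) (as-combination Q (U P Q (suc k)) (U P Q (suc m)) (U P Q k) (U P Q m))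

lemma2p1 : (P Q : ℤ) (R : ℚ) →
    InL P Q R 0 × ((m n : ℕ) → InL P Q R m → InL P Q R n → InL P Q R (m + n))
lemma2p1 P Q R = (ℤ.+ 0 , ℚ.*-zeroˡ R) , InL-+ P Q R
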